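{- Let $D_0$ be a diagram and let $\tilde{D}$ be a minimal element of $\mathcal{P}(D_0)$. Suppose there is a column $c$ of $\tilde{D}$ containing an empty position below a cell (i.e., some $(r,c)\notin\tilde{D}$ and $(r'',c)\in\tilde{D}$ with $r<r''$). Let $r_{\max}$ be the maximum row index with $(r_{\max},c)\in\tilde{D}$. Then there exists a column $c'>c$ such that $(r,c')\in\tilde{D}$ for all $1\le r\le r_{\max}$.
   Context: A diagram is a finite subset of $\mathbb{N}\times\mathbb{N}$; $(r,c)$ is a cell in row $r$, column $c$, rows numbered bottom to top. A Kohnert move on $D$ takes the rightmost cell $(r,c)$ of some row and moves it to $(r',c)$, $r'$ the largest $1\le r'<r$ with $(r',c)\notin D$ (no move if none). $\mathcal{P}(D_0)$ is the set of diagrams obtainable from $D_0$ by finitely many Kohnert moves, ordered by the transitive closure of $D_2<D_1$ when $D_2$ results from $D_1$ by one Kohnert move; a minimal element is one to which no Kohnert move can be applied. -}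

module Defs where

open import Data.Nat using (ℕ; _≤_; _<_)
open import Data.Product using (_×_; _,_; ∃; ∃-syntax)
open import Data.Sum using (_⊎_)
open import Data.List using (List)
open import Data.List.Membership.Propositional using (_∈_; _∉_)
open import Relation.Binary.PropositionalEquality using (_≡_; _≢_)
open import Relation.Binary.Construct.Closure.ReflexiveTransitive using (Star)
open import Relation.Nullary using (¬_)

-- A cell is a pair (row , column); rows are numbered bottom to top, starting at 1.
Cell : Set
Cell = ℕ × ℕ

-- A diagram is a finite set of cells, represented by a list; only membership matters.
Diagram : Set
Diagram = List Cell

WellFormed : Diagram → Set
WellFormed D = ∀ r c → (r , c) ∈ D → 1 ≤ r

-- The rightmost cell (r , c) of row r moves to (r' , c), where r' is the
-- largest 1 ≤ r' < r with (r' , c) ∉ D.  D' is determined up to membership.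
KohnertMove : Diagram → Diagram → Set
KohnertMove D D' =
  ∃[ r ] ∃[ c ] ∃[ r' ]
    ( (r , c) ∈ D
    × (∀ c'' → c < c'' → (r , c'') ∉ D)
    × 1 ≤ r' × r' < r
    × (r' , c) ∉ D
    × (∀ s → r' < s → s < r → (s , c) ∈ D)
    × (∀ x → x ∈ D' → (x ∈ D × x ≢ (r , c)) ⊎ x ≡ (r' , c))
    × (∀ x → (x ∈ D × x ≢ (r , c)) ⊎ x ≡ (r' , c) → x ∈ D') )

InKohnertPoset : Diagram → Diagram → Set
InKohnertPoset D₀ D = Star KohnertMove D₀ D

Minimal : Diagram → Set
Minimal D = ¬ (∃[ D' ] KohnertMove D D')

-- Let c' be the column of the rightmost cell of row rmax.  If some position (s , c')
-- with 1 ≤ s < rmax were empty, the Kohnert move on that rightmost cell would drop it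
-- into the highest such hole, contradicting minimality; so column c' is filled in rows
-- 1 … rmax.  Column c has the hole (r , c) below rmax, hence c ≠ c', and c ≤ c' because
-- (rmax , c) lies in row rmax.
module Submission where

open import Defs
open import Data.Nat using (ℕ; suc; _≤_; _<_; _≟_)
open import Data.Nat.Properties
  using (≤-trans; ≤-pred; ≤∧≢⇒<; <⇒≤; <⇒≱; <-≤-trans; m≤n⇒m<n∨m≡n; m<n⇒m<1+n; n<1+n)
open import Data.Product using (_×_; _,_; proj₁; proj₂; ∃-syntax)
open import Data.Product.Properties using (≡-dec)
open import Data.Sum using (_⊎_; inj₁; inj₂)
open import Data.List using (List; _∷_; filter; map)
open import Data.List.Extrema.Nat using (max; ⊥≤max; xs≤max; argmax-all)
open import Data.List.Relation.Unary.All using (tabulate; lookup)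
open import Data.List.Relation.Unary.Any using (here; there)
open import Data.List.Membership.Propositional using (_∈_; _∉_)
open import Data.List.Membership.Propositional.Properties
  using (∈-map⁺; ∈-map⁻; ∈-filter⁺; ∈-filter⁻)
open import Data.List.Membership.DecPropositional (≡-dec _≟_ _≟_) using (_∈?_)
open import Relation.Binary.PropositionalEquality using (_≡_; _≢_; refl; subst)
open import Relation.Nullary using (Dec; yes; no; ¬?; contradiction)

RightmostInRow : Diagram → Cell → Set
RightmostInRow D (r , c) = (r , c) ∈ D × (∀ c'' → c < c'' → (r , c'') ∉ D)

inRow? : (r : ℕ) (x : Cell) → Dec (proj₁ x ≡ r)
inRow? r x = proj₁ x ≟ r

columnsInRow : ℕ → Diagram → List ℕ
columnsInRow r D = map proj₂ (filter (inRow? r) D)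

∈-columnsInRow⁺ : ∀ {D r c} → (r , c) ∈ D → c ∈ columnsInRow r D
∈-columnsInRow⁺ {r = r} rc∈D = ∈-map⁺ proj₂ (∈-filter⁺ (inRow? r) rc∈D refl)

∈-columnsInRow⁻ : ∀ {D r c} → c ∈ columnsInRow r D → (r , c) ∈ D
∈-columnsInRow⁻ {r = r} c∈cols with ∈-map⁻ proj₂ c∈cols
... | _ , x∈filtered , refl with ∈-filter⁻ (inRow? r) x∈filtered
...   | x∈D , refl = x∈D

rightmostInRow : ∀ {D r c} → (r , c) ∈ D → ∃[ c' ] (c ≤ c' × RightmostInRow D (r , c'))
rightmostInRow {D} {r} {c} rc∈D =
  max c cols , ⊥≤max c cols ,
  argmax-all (λ x → x) {P = λ c' → (r , c') ∈ D} rc∈D (tabulate ∈-columnsInRow⁻) ,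
  λ c'' max<c'' rc''∈D → <⇒≱ max<c'' (lookup (xs≤max c cols) (∈-columnsInRow⁺ rc''∈D))
  where
  cols : List ℕ
  cols = columnsInRow r D

record HighestHoleBelow (D : Diagram) (r c : ℕ) : Set where
  field
    row         : ℕ
    1≤row       : 1 ≤ row
    row<r       : row < r
    row∉D       : (row , c) ∉ D
    filledAbove : ∀ s → row < s → s < r → (s , c) ∈ D

highestHoleBelow : ∀ {D c s} r → 1 ≤ s → s < r → (s , c) ∉ D → HighestHoleBelow D r c
highestHoleBelow {D} {c} {s} (suc k) 1≤s s<1+k sc∉D with (k , c) ∈? D
... | no kc∉D = record
  { row = k ; 1≤row = ≤-trans 1≤s (≤-pred s<1+k) ; row<r = n<1+n k ; row∉D = kc∉D
  ; filledAbove = λ t k<t t<1+k → contradiction (≤-pred t<1+k) (<⇒≱ k<t)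
  }
... | yes kc∈D = extend (highestHoleBelow k 1≤s s<k sc∉D)
  where
  s<k : s < k
  s<k = ≤∧≢⇒< (≤-pred s<1+k) λ { refl → sc∉D kc∈D }
  extend : HighestHoleBelow D k c → HighestHoleBelow D (suc k) c
  extend h = record
    { row = row ; 1≤row = 1≤row ; row<r = m<n⇒m<1+n row<r ; row∉D = row∉D
    ; filledAbove = filledAbove′
    }
    where
    open HighestHoleBelow h
    filledAbove′ : ∀ t → row < t → t < suc k → (t , c) ∈ D
    filledAbove′ t row<t t<1+k with m≤n⇒m<n∨m≡n (≤-pred t<1+k)
    ... | inj₁ t<k  = filledAbove t row<t t<k
    ... | inj₂ refl = kc∈D

kohnertMoveInto : ∀ {D r c} → RightmostInRow D (r , c) → HighestHoleBelow D r c →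
                  ∃[ D' ] KohnertMove D D'
kohnertMoveInto {D} {r} {c} (rc∈D , rightmost) hole =
  (row , c) ∷ filter keep? D ,
  r , c , row , rc∈D , rightmost , 1≤row , row<r , row∉D , filledAbove , result⁻ , result⁺
  where
  open HighestHoleBelow hole
  keep? : (x : Cell) → Dec (x ≢ (r , c))
  keep? x = ¬? (≡-dec _≟_ _≟_ x (r , c))
  result⁻ : ∀ x → x ∈ (row , c) ∷ filter keep? D → (x ∈ D × x ≢ (r , c)) ⊎ x ≡ (row , c)
  result⁻ x (here x≡hole) = inj₂ x≡hole
  result⁻ x (there x∈kept) = inj₁ (∈-filter⁻ keep? x∈kept)
  result⁺ : ∀ x → (x ∈ D × x ≢ (r , c)) ⊎ x ≡ (row , c) → x ∈ (row , c) ∷ filter keep? D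
  result⁺ x (inj₁ (x∈D , x≢rc)) = there (∈-filter⁺ keep? x∈D x≢rc)
  result⁺ x (inj₂ x≡hole) = here x≡hole

minimal⇒rightmostColumnFilled : ∀ {D r c} → Minimal D → RightmostInRow D (r , c) →
                                ∀ s → 1 ≤ s → s ≤ r → (s , c) ∈ D
minimal⇒rightmostColumnFilled {D} {r} {c} minimal rightmost s 1≤s s≤r
  with m≤n⇒m<n∨m≡n s≤r | (s , c) ∈? D
... | inj₂ refl | _ = proj₁ rightmost
... | inj₁ _    | yes sc∈D = sc∈D
... | inj₁ s<r  | no sc∉D =
  contradiction (kohnertMoveInto rightmost (highestHoleBelow r 1≤s s<r sc∉D)) minimal

lemma5p3 : (D₀ D : Diagram) → WellFormed D₀ → InKohnertPoset D₀ D → Minimal D →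
    (c r r'' : ℕ) → 1 ≤ r → (r , c) ∉ D → (r'' , c) ∈ D → r < r'' →
    (rmax : ℕ) → (rmax , c) ∈ D → (∀ s → (s , c) ∈ D → s ≤ rmax) →
    ∃[ c' ] (c < c' × (∀ s → 1 ≤ s → s ≤ rmax → (s , c') ∈ D))
lemma5p3 _ D _ _ minimal c r r'' 1≤r rc∉D r''c∈D r<r'' rmax rmaxc∈D rmax-highest
  with rightmostInRow rmaxc∈D
... | c' , c≤c' , rightmost = c' , c<c' , filled
  where
  filled : ∀ s → 1 ≤ s → s ≤ rmax → (s , c') ∈ D
  filled = minimal⇒rightmostColumnFilled minimal rightmost

  r≤rmax : r ≤ rmax
  r≤rmax = <⇒≤ (<-≤-trans r<r'' (rmax-highest r'' r''c∈D))

  c<c' : c < c'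
  c<c' = ≤∧≢⇒< c≤c' λ c≡c' → subst (λ x → (r , x) ∉ D) c≡c' rc∉D (filled r 1≤r r≤rmax)
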